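{- Let $n\ge3$ and let $\varphi$ be a combinatorial automorphism of $\hat{\mathcal{E}}_n$, viewed (via its action on extreme rays) as a permutation of $\mathscr{L}_n$. Then $\varphi$ permutes the blocks of the partition $(\mathscr{R},\mathscr{C})$ of $\mathscr{L}_n$, i.e. either $\varphi(\mathscr{R})=\mathscr{R}$ and $\varphi(\mathscr{C})=\mathscr{C}$, or $\varphi(\mathscr{R})=\mathscr{C}$ and $\varphi(\mathscr{C})=\mathscr{R}$; and $\varphi$ permutes the blocks of the partition $\{\{R^{(i)},C^{(i)}\}: i=1,\dots,n\}$ of $\mathscr{L}_n$, i.e. for each $i$ there is $j$ with $\varphi(\{R^{(i)},C^{(i)}\})=\{R^{(j)},C^{(j)}\}$.
   Context: Let $N_n=\{(i,j):1\le i,j\le n,\ i\ne j\}$; elements of $\mathbb{R}^{N_n}$ are $n\times n$ real matrices with the diagonal omitted. $\hat{\mathcal{E}}_n$ is the polyhedral cone of $x\in\mathbb{R}^{N_n}$ with $x_{ij}+x_{jk}-x_{ik}\ge0$ and $x_{ij}\ge0$ for all pairwise distinct $i,j,k$. For $r\in[n]$, $R^{(r)}$ is the matrix with all off-diagonal entries of row $r$ equal to $1$ and all other entries $0$, $C^{(r)}$ the analogous matrix for column $r$; $\mathscr{R}=\{R^{(i)}\}_{i=1}^n$, $\mathscr{C}=\{C^{(i)}\}_{i=1}^n$, $\mathscr{L}_n=\mathscr{R}\cup\mathscr{C}$. The rays spanned by elements of $\mathscr{L}_n$ are extreme rays of $\hat{\mathcal{E}}_n$ and the set of these rays is invariant under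 every automorphism of the face lattice of $\hat{\mathcal{E}}_n$, so each such automorphism induces a permutation of $\mathscr{L}_n$. -}

module Defs where

open import Data.Nat using (ℕ)
open import Data.Bool using (Bool; true; false; _∧_; not; if_then_else_)
open import Data.Fin using (Fin)
import Data.Fin as F
open import Data.Rational using (ℚ; 0ℚ; 1ℚ; _+_; _-_; _≤_)
import Data.Rational.Properties as ℚP
open import Data.Product using (Σ; ∃; _×_; proj₁)
open import Relation.Nullary using (¬_)
open import Relation.Nullary.Decidable using (⌊_⌋)
open import Relation.Binary.PropositionalEquality using (_≡_)

-- Elements of ℝ^{N_n}: matrices indexed by Fin n × Fin n; diagonal entries are
-- ignored everywhere below (only entries with i ≢ j are ever used).
-- Rational coordinates are used (the cone is rational, so its face lattice is
-- the same as over ℝ).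
Mat : ℕ → Set
Mat n = Fin n → Fin n → ℚ

distinct : ∀ {n} → Fin n → Fin n → Bool
distinct i j = not ⌊ i F.≟ j ⌋

InCone : ∀ {n} → Mat n → Set
InCone {n} x =
  (∀ (i j k : Fin n) → ¬ i ≡ j → ¬ j ≡ k → ¬ i ≡ k → 0ℚ ≤ (x i j + x j k) - x i k)
  × (∀ (i j : Fin n) → ¬ i ≡ j → 0ℚ ≤ x i j)

-- A set of defining inequalities of Ê_n (as characteristic functions; entries
-- at non-pairwise-distinct indices do not correspond to inequalities and are
-- always false for equality sets).
record TS (n : ℕ) : Set where
  field
    tri : Fin n → Fin n → Fin n → Bool   -- x_ij + x_jk - x_ik ≥ 0
    nn  : Fin n → Fin n → Bool           -- x_ij ≥ 0
open TS public

_≐_ : ∀ {n} → TS n → TS n → Set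
S ≐ T = (∀ i j k → tri S i j k ≡ tri T i j k) × (∀ i j → nn S i j ≡ nn T i j)

_⊆ₜ_ : ∀ {n} → TS n → TS n → Set
S ⊆ₜ T = (∀ i j k → tri S i j k ≡ true → tri T i j k ≡ true)
       × (∀ i j → nn S i j ≡ true → nn T i j ≡ true)

eqSet : ∀ {n} → Mat n → TS n
tri (eqSet x) i j k = distinct i j ∧ distinct j k ∧ distinct i k
                      ∧ ⌊ (x i j + x j k) - x i k ℚP.≟ 0ℚ ⌋
nn (eqSet x) i j = distinct i j ∧ ⌊ x i j ℚP.≟ 0ℚ ⌋

-- Faces of Ê_n, each represented by its equality set (the set of defining
-- inequalities tight on the face, equivalently at a relative-interior point).
-- The face lattice is the set of these, ordered by REVERSE inclusion.
IsFace : ∀ {n} → TS n → Set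
IsFace {n} S = Σ (Mat n) λ x → InCone x × (eqSet x ≐ S)

Face : ℕ → Set
Face n = Σ (TS n) IsFace

ts : ∀ {n} → Face n → TS n
ts = proj₁

-- combinatorial automorphism: an automorphism of the face lattice, i.e. a
-- surjective map of faces that preserves and reflects the order (which forces
-- injectivity up to equality of faces).
IsCombAut : ∀ {n} → (Face n → Face n) → Set
IsCombAut {n} φ =
  (∀ (F G : Face n) → (ts F ⊆ₜ ts G) → (ts (φ F) ⊆ₜ ts (φ G)))
  × (∀ (F G : Face n) → (ts (φ F) ⊆ₜ ts (φ G)) → (ts F ⊆ₜ ts G))
  × (∀ (G : Face n) → Σ (Face n) λ F → ts (φ F) ≐ ts G)

Rm : ∀ {n} → Fin n → Mat n
Rm r i j = if ⌊ i F.≟ r ⌋ ∧ distinct i j then 1ℚ else 0ℚ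

Cm : ∀ {n} → Fin n → Mat n
Cm r i j = if ⌊ j F.≟ r ⌋ ∧ distinct i j then 1ℚ else 0ℚ

Sends : ∀ {n} → (Face n → Face n) → Mat n → Mat n → Set
Sends {n} φ A B = ∀ (F : Face n) → ts F ≐ eqSet A → ts (φ F) ≐ eqSet B

{-# OPTIONS --safe #-}
module Submission where

-- Faces are represented by their equality sets, and φ is an automorphism of the face order ⊑.
-- Facets are its coatoms, so φ permutes the defining inequalities, e ↦ e′, in such a way that e is
-- tight on F iff e′ is tight on φ F.  The rays R^(a), C^(a) are atoms, and a defining inequality is
-- non-tight on R^(a) (on C^(a)) iff its key is a: the middle index of a triangle inequality, the
-- first (second) index of x_ij ≥ 0.  So the images of R^(1), …, R^(n) are rays whose sets of
-- non-tight inequalities partition all defining inequalities.  Colour the arc uv by the image whose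
-- point has a non-zero uv-entry: by the triangle inequalities the colour of ac is that of ab or of
-- bc, and n ≥ 3 colours occur.  Such a colouring is constant along rows or along columns, which
-- makes the images all of the form R^(j) or all of the form C^(j).  Finally R^(i) and C^(i) are
-- both non-tight on x_pi + x_iq ≥ x_pq and on x_qi + x_ip ≥ x_qp, which forces their images to
-- have a common index, and then to be of different forms since φ is injective.

open import Defs
open import Data.Bool using (Bool; true; false; not; _∧_; _∨_; if_then_else_) renaming (_≟_ to _≟ᵇ_)
open import Data.Bool.Properties using (∧-identityʳ; not-involutive)
open import Data.Empty using (⊥; ⊥-elim)
open import Data.Fin using (Fin)
import Data.Fin as F
import Data.Fin.Properties as FP
open import Data.Nat using (ℕ; suc; _≤_; s≤s; z≤n)
import Data.Nat as ℕ
open import Data.Product using (∃; ∃₂; _×_; _,_; proj₁; proj₂; swap)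
import Data.Product as Product
open import Data.Rational using (ℚ; 0ℚ; 1ℚ; _+_; _-_; -_; _≤?_) renaming (_≤_ to _≤ℚ_)
import Data.Rational.Properties as ℚP
open import Algebra.Properties.Group ℚP.+-0-group using (x∙y⁻¹≈ε⇒x≈y)
open import Data.Rational.Solver using (module +-*-Solver)
open import Data.Sum using (_⊎_; inj₁; inj₂)
import Data.Sum as Sum
open import Level using (_⊔_)
open import Function using (id; _∘_; _⇔_; mk⇔; flip; case_of_; Equivalence)
open import Relation.Binary.Definitions using (DecidableEquality)
open import Relation.Binary.PropositionalEquality
open import Relation.Nullary using (¬_; Dec; yes; no; ¬?; _×-dec_)
open import Relation.Nullary.Decidable using (⌊_⌋; True; toWitness; decidable-stable; map′)

private
  variable
    n : ℕ

decide-≤ : ∀ {p q} → True (p ≤? q) → p ≤ℚ q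
decide-≤ {p} {q} = toWitness {a? = p ≤? q}

nonneg-+-zeroˡ : ∀ {p q} → 0ℚ ≤ℚ p → 0ℚ ≤ℚ q → p + q ≡ 0ℚ → p ≡ 0ℚ
nonneg-+-zeroˡ {p} {q} 0≤p 0≤q p+q≡0 = ℚP.≤-antisym p≤0 0≤p
  where
  open ℚP.≤-Reasoning
  p≤0 : p ≤ℚ 0ℚ
  p≤0 = begin
    p       ≡⟨ sym (ℚP.+-identityʳ p) ⟩
    p + 0ℚ  ≤⟨ ℚP.+-monoʳ-≤ p 0≤q ⟩
    p + q   ≡⟨ p+q≡0 ⟩
    0ℚ      ∎

nonneg-+-zeroʳ : ∀ {p q} → 0ℚ ≤ℚ p → 0ℚ ≤ℚ q → p + q ≡ 0ℚ → q ≡ 0ℚ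
nonneg-+-zeroʳ {p} {q} 0≤p 0≤q p+q≡0 = nonneg-+-zeroˡ 0≤q 0≤p (trans (ℚP.+-comm q p) p+q≡0)

-≡0⇒≡ : ∀ {p q} → p - q ≡ 0ℚ → p ≡ q
-≡0⇒≡ {p} {q} = x∙y⁻¹≈ε⇒x≈y p q

0≤z∧0≤-z⇒z≡0 : ∀ {z} → 0ℚ ≤ℚ z → 0ℚ ≤ℚ - z → z ≡ 0ℚ
0≤z∧0≤-z⇒z≡0 {z} 0≤z 0≤-z = nonneg-+-zeroˡ 0≤z 0≤-z (ℚP.+-inverseʳ z)

isYes⇒ : ∀ {a} {A : Set a} (d : Dec A) → ⌊ d ⌋ ≡ true → A
isYes⇒ (yes a) _ = a

isYes⇐ : ∀ {a} {A : Set a} (d : Dec A) → A → ⌊ d ⌋ ≡ true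
isYes⇐ (yes _) _ = refl
isYes⇐ (no ¬a) a = ⊥-elim (¬a a)

isNo⇐ : ∀ {a} {A : Set a} (d : Dec A) → ¬ A → ⌊ d ⌋ ≡ false
isNo⇐ (yes a) ¬a = ⊥-elim (¬a a)
isNo⇐ (no _) _ = refl

∧-true : ∀ a {b} → a ∧ b ≡ true → a ≡ true × b ≡ true
∧-true true b≡true = refl , b≡true

∨-true : ∀ p {q} → p ∨ q ≡ true → p ≡ true ⊎ q ≡ true
∨-true true  _ = inj₁ refl
∨-true false q = inj₂ q

bool-antisym : {a b : Bool} → (a ≡ true → b ≡ true) → (b ≡ true → a ≡ true) → a ≡ b
bool-antisym {true}  a⇒b _ = sym (a⇒b refl)
bool-antisym {false} {false} _ _ = refl
bool-antisym {false} {true} _ b⇒a = b⇒a refl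

-- Atoms under order automorphisms

module Atoms {a ℓ} {A : Set a} (_≤_ : A → A → Set ℓ) (≤-trans : ∀ {x y z} → x ≤ y → y ≤ z → x ≤ z) where

  _≃_ : A → A → Set ℓ
  x ≃ y = x ≤ y × y ≤ x

  IsAtom : A → A → Set (a ⊔ ℓ)
  IsAtom m x = ¬ x ≤ m × (∀ y → y ≤ x → y ≤ m ⊎ x ≤ y)

  ≃-trans : ∀ {x y z} → x ≃ y → y ≃ z → x ≃ z
  ≃-trans (x≤y , y≤x) (y≤z , z≤y) = ≤-trans x≤y y≤z , ≤-trans z≤y y≤x

  atom-resp-≃ : ∀ {m x y} → x ≃ y → IsAtom m x → IsAtom m y
  atom-resp-≃ (x≤y , y≤x) (x≰m , split) =
    (λ y≤m → x≰m (≤-trans x≤y y≤m)) , (λ z z≤y → Sum.map₂ (≤-trans y≤x) (split z (≤-trans z≤y y≤x)))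

  module Automorphism (φ : A → A)
    (φ-mono : ∀ {x y} → x ≤ y → φ x ≤ φ y) (φ-reflect : ∀ {x y} → φ x ≤ φ y → x ≤ y)
    (φ-onto : ∀ y → ∃ λ x → φ x ≃ y) where

    φ-least : ∀ {m} → (∀ y → m ≤ y) → ∀ y → φ m ≤ y
    φ-least m≤ y = let x , φx≤y , _ = φ-onto y in ≤-trans (φ-mono (m≤ x)) φx≤y

    φ-atom : ∀ {m x} → (∀ y → m ≤ y) → IsAtom m x → IsAtom m (φ x)
    φ-atom {m} {x} m≤ (x≰m , split) = φx≰m , φsplit
      where
      φx≰m : ¬ φ x ≤ m
      φx≰m φx≤m = x≰m (φ-reflect (≤-trans φx≤m (m≤ (φ m))))
      φsplit : ∀ y → y ≤ φ x → y ≤ m ⊎ φ x ≤ y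
      φsplit y y≤φx =
        let z , φz≤y , y≤φz = φ-onto y in
        Sum.map (λ z≤m → ≤-trans y≤φz (≤-trans (φ-mono z≤m) (φ-least m≤ m)))
                (λ x≤z → ≤-trans (φ-mono x≤z) φz≤y)
                (split z (φ-reflect (≤-trans φz≤y y≤φx)))

    φ-atom⁻ : ∀ {m y} → (∀ z → m ≤ z) → IsAtom m y → ∃ λ x → IsAtom m x × φ x ≃ y
    φ-atom⁻ {m} {y} m≤ y-atom = x , atom-reflect (atom-resp-≃ (swap φx≃y) y-atom) , φx≃y
      where
      x : A
      x = proj₁ (φ-onto y)
      φx≃y : φ x ≃ y
      φx≃y = proj₂ (φ-onto y)
      atom-reflect : IsAtom m (φ x) → IsAtom m x
      atom-reflect (φx≰m , split) =
        (λ x≤m → φx≰m (≤-trans (φ-mono x≤m) (φ-least m≤ m))) ,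
        (λ z z≤x → Sum.map (λ φz≤m → φ-reflect (≤-trans φz≤m (m≤ (φ m)))) φ-reflect (split (φ z) (φ-mono z≤x)))

-- Arc colourings

module _ {ℓ} {C : Set ℓ} {n : ℕ} (o : Fin n → Fin n → C) where

  RowConstant : Set ℓ
  RowConstant = ∀ {a b c} → a ≢ b → a ≢ c → o a b ≡ o a c

  ColumnConstant : Set ℓ
  ColumnConstant = ∀ {a b c} → a ≢ c → b ≢ c → o a c ≡ o b c

module ArcColouring {ℓ} {C : Set ℓ} (_≟ᶜ_ : DecidableEquality C) {n : ℕ} (o : Fin n → Fin n → C)
  (detour : ∀ {a b c} → a ≢ b → b ≢ c → a ≢ c → o a c ≡ o a b ⊎ o a c ≡ o b c)
  (not-two-coloured : ∀ α β → ¬ (∀ {u v} → u ≢ v → o u v ≡ α ⊎ o u v ≡ β)) where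

  infix 4 _∈⟨_,_⟩

  _∈⟨_,_⟩ : C → C → C → Set ℓ
  γ ∈⟨ α , β ⟩ = γ ≡ α ⊎ γ ≡ β

  vertex-not-two-coloured : ∀ v α β → ¬ (∀ {x} → x ≢ v → o v x ∈⟨ α , β ⟩ × o x v ∈⟨ α , β ⟩)
  vertex-not-two-coloured v α β at-v = not-two-coloured α β coloured
    where
    coloured : ∀ {u w} → u ≢ w → o u w ∈⟨ α , β ⟩
    coloured {u} {w} u≢w with u F.≟ v | w F.≟ v
    ... | yes refl | _        = proj₁ (at-v (u≢w ∘ sym))
    ... | no u≢v   | yes refl = proj₂ (at-v u≢v)
    ... | no u≢v   | no w≢v   with detour u≢v (w≢v ∘ sym) u≢w
    ...   | inj₁ uw≡uv = subst (_∈⟨ α , β ⟩) (sym uw≡uv) (proj₂ (at-v u≢v))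
    ...   | inj₂ uw≡vw = subst (_∈⟨ α , β ⟩) (sym uw≡vw) (proj₁ (at-v w≢v))

  row-split : ∀ {a b c} → a ≢ b → b ≢ c → a ≢ c → o a b ≢ o a c → o c b ≡ o a b × o b c ≡ o a c
  row-split a≢b b≢c a≢c ab≢ac =
    Sum.[ ⊥-elim ∘ ab≢ac , sym ] (detour a≢c (b≢c ∘ sym) a≢b) ,
    Sum.[ ⊥-elim ∘ ab≢ac ∘ sym , sym ] (detour a≢b b≢c a≢c)

  column-split : ∀ {a d b} → a ≢ d → d ≢ b → a ≢ b → o a b ≢ o d b → o a d ≡ o a b × o d a ≡ o d b
  column-split a≢d d≢b a≢b ab≢db =
    Sum.[ sym , ⊥-elim ∘ ab≢db ] (detour a≢d d≢b a≢b) ,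
    Sum.[ sym , ⊥-elim ∘ ab≢db ∘ sym ] (detour (a≢d ∘ sym) a≢b d≢b)

  -- If o e d ≢ o a d, every arc at a has colour o a d or o a t.
  module TwoColouredAt {a d t e} (a≢d : a ≢ d) (d≢t : d ≢ t) (a≢t : a ≢ t)
    (e≢a : e ≢ a) (e≢d : e ≢ d) (e≢t : e ≢ t) (α≢β : o a d ≢ o a t) (ed≢ad : o e d ≢ o a d) where

    α β : C
    α = o a d
    β = o a t

    ae≡α : o a e ≡ α
    ae≡α = proj₁ (column-split (e≢a ∘ sym) e≢d a≢d (ed≢ad ∘ sym))

    ea≡ed : o e a ≡ o e d
    ea≡ed = proj₂ (column-split (e≢a ∘ sym) e≢d a≢d (ed≢ad ∘ sym))

    ae≢β : o a e ≢ β
    ae≢β = α≢β ∘ trans (sym ae≡α)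

    te≡α : o t e ≡ α
    te≡α = trans (proj₁ (row-split (e≢a ∘ sym) e≢t a≢t ae≢β)) ae≡α

    et≡β : o e t ≡ β
    et≡β = proj₂ (row-split (e≢a ∘ sym) e≢t a≢t ae≢β)

    ed≡β : o e d ≡ β
    ed≡β = trans (sym (proj₂ (column-split (e≢t ∘ sym) e≢d (d≢t ∘ sym) td≢ed))) et≡β
      where
      td≢ed : o t d ≢ o e d
      td≢ed td≡ed = ed≢ad (trans (sym td≡ed) (proj₁ (row-split a≢d d≢t a≢t α≢β)))

    ea≡β : o e a ≡ β
    ea≡β = trans ea≡ed ed≡β

    ta∈ : o t a ∈⟨ α , β ⟩
    ta∈ = Sum.map (λ ta≡te → trans ta≡te te≡α) (λ ta≡ea → trans ta≡ea ea≡β) (detour (e≢t ∘ sym) e≢a (a≢t ∘ sym))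

    outgoing : ∀ {x} → x ≢ a → o a x ∈⟨ α , β ⟩
    outgoing {x} x≢a with x F.≟ d | x F.≟ e
    ... | yes refl | _        = inj₁ refl
    ... | no _     | yes refl = inj₁ ae≡α
    ... | no x≢d   | no x≢e   with o a x ≟ᶜ α | o a x ≟ᶜ β
    ...   | yes ax≡α | _        = inj₁ ax≡α
    ...   | no _     | yes ax≡β = inj₂ ax≡β
    ...   | no ax≢α  | no ax≢β  = ⊥-elim (
      Sum.[ (λ ed≡ex → ax≢β (trans (sym ex≡ax) (trans (sym ed≡ex) ed≡β)))
          , (λ ed≡xd → α≢β (trans (sym xd≡α) (trans (sym ed≡xd) ed≡β))) ]
        (detour (x≢e ∘ sym) x≢d e≢d))
      where
      xd≡α : o x d ≡ α
      xd≡α = proj₁ (row-split a≢d (x≢d ∘ sym) (x≢a ∘ sym) (ax≢α ∘ sym))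
      ex≡ax : o e x ≡ o a x
      ex≡ax = proj₂ (row-split (e≢a ∘ sym) (x≢e ∘ sym) (x≢a ∘ sym) (λ ae≡ax → ax≢α (trans (sym ae≡ax) ae≡α)))

    incoming : ∀ {x} → x ≢ a → o x a ∈⟨ α , β ⟩
    incoming {x} x≢a with x F.≟ e | x F.≟ t | x F.≟ d
    ... | yes refl | _        | _        = inj₂ ea≡β
    ... | no _     | yes refl | _        = ta∈
    ... | no _     | no _     | yes refl =
      Sum.[ (λ da≡dt → inj₂ (trans da≡dt (proj₂ (row-split a≢d d≢t a≢t α≢β))))
          , (λ da≡ta → subst (_∈⟨ α , β ⟩) (sym da≡ta) ta∈) ] (detour d≢t (a≢t ∘ sym) (a≢d ∘ sym))
    ... | no x≢e   | no x≢t   | no x≢d   with o x d ≟ᶜ α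
    ...   | yes xd≡α = Sum.map (λ xa≡xe → trans xa≡xe (trans xe≡xd xd≡α)) (λ xa≡ea → trans xa≡ea ea≡β)
                               (detour x≢e e≢a x≢a)
      where
      xe≡xd : o x e ≡ o x d
      xe≡xd = proj₂ (column-split (x≢e ∘ sym) x≢d e≢d
                                  (λ ed≡xd → α≢β (trans (sym xd≡α) (trans (sym ed≡xd) ed≡β))))
    ...   | no xd≢α  = Sum.[ (λ xa≡xt → inj₂ (trans xa≡xt xt≡β))
                           , (λ xa≡ta → subst (_∈⟨ α , β ⟩) (sym xa≡ta) ta∈) ]
                               (detour x≢t (a≢t ∘ sym) x≢a)
      where
      ax≡α : o a x ≡ α
      ax≡α = proj₁ (column-split (x≢a ∘ sym) x≢d a≢d (xd≢α ∘ sym))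
      xt≡β : o x t ≡ β
      xt≡β = proj₂ (row-split (x≢a ∘ sym) x≢t a≢t (α≢β ∘ trans (sym ax≡α)))

  column-constant : ∀ {a d t} → a ≢ d → d ≢ t → a ≢ t → o a d ≢ o a t → ∀ {e} → e ≢ d → o e d ≡ o a d
  column-constant {a} {d} {t} a≢d d≢t a≢t α≢β {e} e≢d with e F.≟ a | e F.≟ t
  ... | yes refl | _        = refl
  ... | no _     | yes refl = proj₁ (row-split a≢d d≢t a≢t α≢β)
  ... | no e≢a   | no e≢t   = decidable-stable (o e d ≟ᶜ o a d) λ ed≢ad →
    let open TwoColouredAt a≢d d≢t a≢t e≢a e≢d e≢t α≢β ed≢ad in
    vertex-not-two-coloured a α β (λ x≢a → outgoing x≢a , incoming x≢a)

  columns-constant : ∀ {a b c} → a ≢ b → a ≢ c → o a b ≢ o a c →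
                     ∀ {q} → q ≢ a → ∀ {x y} → x ≢ q → y ≢ q → o x q ≡ o y q
  columns-constant {a} {b} {c} a≢b a≢c ab≢ac {q} q≢a x≢q y≢q = trans (to-aq x≢q) (sym (to-aq y≢q))
    where
    to-aq : ∀ {z} → z ≢ q → o z q ≡ o a q
    to-aq z≢q with o a q ≟ᶜ o a b
    ... | yes aq≡ab = column-constant (q≢a ∘ sym) q≢c a≢c (λ aq≡ac → ab≢ac (trans (sym aq≡ab) aq≡ac)) z≢q
      where
      q≢c : q ≢ c
      q≢c refl = ab≢ac (sym aq≡ab)
    ... | no aq≢ab = column-constant (q≢a ∘ sym) q≢b a≢b aq≢ab z≢q
      where
      q≢b : q ≢ b
      q≢b refl = aq≢ab refl

module _ {ℓ} {C : Set ℓ} (_≟ᶜ_ : DecidableEquality C) {n : ℕ} (o : Fin n → Fin n → C)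
  (detour : ∀ {a b c} → a ≢ b → b ≢ c → a ≢ c → o a c ≡ o a b ⊎ o a c ≡ o b c)
  (not-two-coloured : ∀ α β → ¬ (∀ {u v} → u ≢ v → o u v ≡ α ⊎ o u v ≡ β)) where

  private
    module O = ArcColouring _≟ᶜ_ o detour not-two-coloured
    module Oᵀ = ArcColouring _≟ᶜ_ (flip o)
      (λ a≢b b≢c a≢c → Sum.swap (detour (b≢c ∘ sym) (a≢b ∘ sym) (a≢c ∘ sym)))
      (λ α β two → not-two-coloured α β (λ u≢v → two (u≢v ∘ sym)))

  -- A split row a makes every column q ≢ a constant, and dually; so q ≡ a, and then a vertex
  -- b ≢ a sees only the colours o b a and o a b.
  row-and-column-split : ∀ {a b c q x y} → a ≢ b → a ≢ c → o a b ≢ o a c →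
                         x ≢ q → y ≢ q → o x q ≢ o y q → ⊥
  row-and-column-split {a} {b} {q = q} a≢b a≢c ab≢ac x≢q y≢q xq≢yq with q F.≟ a
  ... | no q≢a   = xq≢yq (O.columns-constant a≢b a≢c ab≢ac q≢a x≢q y≢q)
  ... | yes refl = O.vertex-not-two-coloured b (o b q) (o q b) λ z≢b →
    inj₁ (Oᵀ.columns-constant (x≢q ∘ sym) (y≢q ∘ sym) xq≢yq (a≢b ∘ sym) z≢b a≢b) ,
    inj₂ (O.columns-constant a≢b a≢c ab≢ac (a≢b ∘ sym) z≢b a≢b)

  classify : RowConstant o ⊎ ColumnConstant o
  classify
    with FP.any? (λ a → FP.any? λ b → FP.any? λ c → ¬? (a F.≟ b) ×-dec ¬? (a F.≟ c) ×-dec ¬? (o a b ≟ᶜ o a c))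
  ... | no no-row-split = inj₁ λ {a} {b} {c} a≢b a≢c →
    decidable-stable (o a b ≟ᶜ o a c) λ ab≢ac → no-row-split (a , b , c , a≢b , a≢c , ab≢ac)
  ... | yes (a , b , c , a≢b , a≢c , ab≢ac) = inj₂ λ {x} {y} {q} x≢q y≢q →
    decidable-stable (o x q ≟ᶜ o y q) (row-and-column-split a≢b a≢c ab≢ac x≢q y≢q)

-- Defining inequalities and equality sets

≢⇒distinct : {i j : Fin n} → i ≢ j → distinct i j ≡ true
≢⇒distinct {i = i} {j} i≢j = cong not (isNo⇐ (i F.≟ j) i≢j)

distinct⇒≢ : {i j : Fin n} → distinct i j ≡ true → i ≢ j
distinct⇒≢ {i = i} {j} d i≡j = false≢true (trans (sym (cong not (isYes⇐ (i F.≟ j) i≡j))) d)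
  where
  false≢true : false ≢ true
  false≢true ()

distinct-false : {i j : Fin n} → distinct i j ≡ false → i ≡ j
distinct-false {i = i} {j} d = isYes⇒ (i F.≟ j) (trans (sym (not-involutive _)) (cong not d))

distinct-refl : (i : Fin n) → distinct i i ≡ false
distinct-refl i = cong not (isYes⇐ (i F.≟ i) refl)

data Ineq (n : ℕ) : Set where
  triangle : (i j k : Fin n) → Ineq n
  nonneg   : (i j : Fin n) → Ineq n

triangle-injectiveˡ : {i j k i′ j′ k′ : Fin n} → triangle i j k ≡ triangle i′ j′ k′ → i ≡ i′
triangle-injectiveˡ refl = refl

Valid : Ineq n → Set
Valid (triangle i j k) = i ≢ j × j ≢ k × i ≢ k
Valid (nonneg i j)     = i ≢ j

infix 4 _∈_ _∉_ _⊆_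

mem : TS n → Ineq n → Bool
mem S (triangle i j k) = tri S i j k
mem S (nonneg i j)     = nn S i j

-- A record rather than a function of e, so that e and S can be inferred from e ∈ S.
record _∈_ (e : Ineq n) (S : TS n) : Set where
  constructor ∈-intro
  field ∈-true : mem S e ≡ true

_∉_ : Ineq n → TS n → Set
e ∉ S = ¬ e ∈ S

_∈?_ : (e : Ineq n) (S : TS n) → Dec (e ∈ S)
e ∈? S = map′ ∈-intro _∈_.∈-true (mem S e ≟ᵇ true)

_⊆_ : TS n → TS n → Set
S ⊆ T = ∀ {e} → e ∈ S → e ∈ T

⊆ₜ⇒⊆ : {S T : TS n} → S ⊆ₜ T → S ⊆ T
⊆ₜ⇒⊆ (S⊆T , _) {triangle i j k} (∈-intro e∈) = ∈-intro (S⊆T i j k e∈)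
⊆ₜ⇒⊆ (_ , S⊆T) {nonneg i j}     (∈-intro e∈) = ∈-intro (S⊆T i j e∈)

⊆⇒⊆ₜ : {S T : TS n} → S ⊆ T → S ⊆ₜ T
⊆⇒⊆ₜ S⊆T = (λ i j k e∈ → _∈_.∈-true (S⊆T {triangle i j k} (∈-intro e∈)))
          , (λ i j e∈ → _∈_.∈-true (S⊆T {nonneg i j} (∈-intro e∈)))

≐⇒⊆ₜ : {S T : TS n} → S ≐ T → S ⊆ₜ T
≐⇒⊆ₜ (tri≡ , nn≡) = (λ i j k → trans (sym (tri≡ i j k))) , (λ i j → trans (sym (nn≡ i j)))

≐-sym : {S T : TS n} → S ≐ T → T ≐ S
≐-sym (tri≡ , nn≡) = (λ i j k → sym (tri≡ i j k)) , (λ i j → sym (nn≡ i j))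

⊆ₜ-antisym : {S T : TS n} → S ⊆ₜ T → T ⊆ₜ S → S ≐ T
⊆ₜ-antisym (S⊆T , S⊆T′) (T⊆S , T⊆S′) =
  (λ i j k → bool-antisym (S⊆T i j k) (T⊆S i j k)) , (λ i j → bool-antisym (S⊆T′ i j) (T⊆S′ i j))

slack : Mat n → Ineq n → ℚ
slack x (triangle i j k) = (x i j + x j k) - x i k
slack x (nonneg i j)     = x i j

∈-eqSet⁻ : {x : Mat n} {e : Ineq n} → e ∈ eqSet x → Valid e × slack x e ≡ 0ℚ
∈-eqSet⁻ {x = x} {triangle i j k} (∈-intro e∈)
  with ij , e∈₁ ← ∧-true (distinct i j) e∈
  with jk , e∈₂ ← ∧-true (distinct j k) e∈₁
  with ik , tight ← ∧-true (distinct i k) e∈₂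
  = (distinct⇒≢ ij , distinct⇒≢ jk , distinct⇒≢ ik) , isYes⇒ (slack x (triangle i j k) ℚP.≟ 0ℚ) tight
∈-eqSet⁻ {x = x} {nonneg i j} (∈-intro e∈) with ij , tight ← ∧-true (distinct i j) e∈ =
  distinct⇒≢ ij , isYes⇒ (x i j ℚP.≟ 0ℚ) tight

mem-eqSet : {x : Mat n} {e : Ineq n} → Valid e → mem (eqSet x) e ≡ ⌊ slack x e ℚP.≟ 0ℚ ⌋
mem-eqSet {e = triangle i j k} (ij , jk , ik) rewrite ≢⇒distinct ij | ≢⇒distinct jk | ≢⇒distinct ik = refl
mem-eqSet {e = nonneg i j} ij rewrite ≢⇒distinct ij = refl

∈-eqSet⁺ : {x : Mat n} {e : Ineq n} → Valid e → slack x e ≡ 0ℚ → e ∈ eqSet x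
∈-eqSet⁺ {x = x} {e} ve tight = ∈-intro (trans (mem-eqSet ve) (isYes⇐ (slack x e ℚP.≟ 0ℚ) tight))

slack-cong : {x y : Mat n} → (∀ {i j} → i ≢ j → x i j ≡ y i j) → {e : Ineq n} → Valid e → slack x e ≡ slack y e
slack-cong x≗y {triangle i j k} (ij , jk , ik) = cong₂ _-_ (cong₂ _+_ (x≗y ij) (x≗y jk)) (x≗y ik)
slack-cong x≗y {nonneg i j} ij = x≗y ij

slack-nonneg : {x : Mat n} → InCone x → {e : Ineq n} → Valid e → 0ℚ ≤ℚ slack x e
slack-nonneg (tri≥0 , _) {triangle i j k} (ij , jk , ik) = tri≥0 i j k ij jk ik
slack-nonneg (_ , nn≥0) {nonneg i j} ij = nn≥0 i j ij

inCone : {x : Mat n} → (∀ {e} → Valid e → 0ℚ ≤ℚ slack x e) → InCone x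
inCone slack≥0 = (λ i j k ij jk ik → slack≥0 {triangle i j k} (ij , jk , ik))
               , (λ i j ij → slack≥0 {nonneg i j} ij)

member? : (S : TS n) → Dec (∃ λ e → e ∈ S)
member? S with FP.any? (λ i → FP.any? λ j → FP.any? λ k → tri S i j k ≟ᵇ true)
... | yes (i , j , k , t) = yes (triangle i j k , ∈-intro t)
... | no ¬tri with FP.any? (λ i → FP.any? λ j → nn S i j ≟ᵇ true)
...   | yes (i , j , t) = yes (nonneg i j , ∈-intro t)
...   | no ¬nn = no λ { (triangle i j k , ∈-intro t) → ¬tri (i , j , k , t)
                      ; (nonneg i j , ∈-intro t) → ¬nn (i , j , t) }

face : (x : Mat n) → InCone x → Face n
face x x∈ = eqSet x , x , x∈ , (λ _ _ _ → refl) , (λ _ _ → refl)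

point : Face n → Mat n
point F = proj₁ (proj₂ F)

point-inCone : (F : Face n) → InCone (point F)
point-inCone F = proj₁ (proj₂ (proj₂ F))

ts⊆eqSet : (F : Face n) → ts F ⊆ eqSet (point F)
ts⊆eqSet F = ⊆ₜ⇒⊆ (≐⇒⊆ₜ (≐-sym (proj₂ (proj₂ (proj₂ F)))))

eqSet⊆ts : (F : Face n) → eqSet (point F) ⊆ ts F
eqSet⊆ts F = ⊆ₜ⇒⊆ (≐⇒⊆ₜ (proj₂ (proj₂ (proj₂ F))))

ts-valid : (F : Face n) {e : Ineq n} → e ∈ ts F → Valid e
ts-valid F e∈ = proj₁ (∈-eqSet⁻ (ts⊆eqSet F e∈))

infix 4 _⊑_

-- F is a face of G.  A record for the same reason as _∈_: ts is not injective.
record _⊑_ (F G : Face n) : Set where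
  constructor ⊑-intro
  field ts-⊇ : ts G ⊆ ts F
open _⊑_ public

⊑-trans : {F G H : Face n} → F ⊑ G → G ⊑ H → F ⊑ H
⊑-trans (⊑-intro G⊆F) (⊑-intro H⊆G) = ⊑-intro (λ e∈ → G⊆F (H⊆G e∈))

module _ {m : ℕ} where
  open Atoms (_⊑_ {m}) ⊑-trans public
  open Atoms (flip (_⊑_ {m})) (λ y⊑x z⊑y → ⊑-trans z⊑y y⊑x) public
    using () renaming (IsAtom to IsCoatom; module Automorphism to CoatomAutomorphism)

constMat : ℚ → Mat n
constMat t _ _ = t

slack-constMat : ∀ t (e : Ineq n) → slack (constMat t) e ≡ t
slack-constMat t (triangle _ _ _) = solve 1 (λ t → (t :+ t) :- t := t) refl t
  where open +-*-Solver
slack-constMat t (nonneg _ _) = refl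

constMat-inCone : ∀ {t} → 0ℚ ≤ℚ t → InCone (constMat {n} t)
constMat-inCone {t = t} 0≤t = inCone (λ {e} _ → subst (0ℚ ≤ℚ_) (sym (slack-constMat t e)) 0≤t)

-- The faces {0} and Ê_n.  Rays are the atoms above apex, facets the coatoms below whole.
apex : Face n
apex = face (constMat 0ℚ) (constMat-inCone ℚP.≤-refl)

whole : Face n
whole = face (constMat 1ℚ) (constMat-inCone (decide-≤ _))

apex-least : (F : Face n) → apex ⊑ F
apex-least F = ⊑-intro (λ {e} e∈ → ∈-eqSet⁺ (ts-valid F e∈) (slack-constMat 0ℚ e))

∉-whole : {e : Ineq n} → e ∉ ts whole
∉-whole {e = e} e∈ = ℚP.1≢0 (trans (sym (slack-constMat 1ℚ e)) (proj₂ (∈-eqSet⁻ e∈)))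

whole-greatest : (F : Face n) → F ⊑ whole
whole-greatest F = ⊑-intro (λ e∈ → ⊥-elim (∉-whole e∈))

nonzero-entry : (F : Face n) → ¬ F ⊑ apex → ∃₂ λ u v → u ≢ v × point F u v ≢ 0ℚ
nonzero-entry F F⋢apex = from-search (FP.any? λ u → FP.any? λ v → ¬? (u F.≟ v) ×-dec ¬? (point F u v ℚP.≟ 0ℚ))
  where
  from-search : Dec (∃₂ λ u v → u ≢ v × point F u v ≢ 0ℚ) → ∃₂ λ u v → u ≢ v × point F u v ≢ 0ℚ
  from-search (yes found) = found
  from-search (no none) = ⊥-elim (F⋢apex (⊑-intro λ {e} e∈ → let ve = ts-valid apex e∈ in
      eqSet⊆ts F (∈-eqSet⁺ ve (trans (slack-cong entries-zero ve) (slack-constMat 0ℚ e)))))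
    where
    entries-zero : ∀ {u v} → u ≢ v → point F u v ≡ 0ℚ
    entries-zero {u} {v} u≢v = decidable-stable (point F u v ℚP.≟ 0ℚ) (λ x≢0 → none (u , v , u≢v , x≢0))

≐⇒≃ : {F G : Face n} → ts F ≐ ts G → F ≃ G
≐⇒≃ F≐G = ⊑-intro (⊆ₜ⇒⊆ (≐⇒⊆ₜ (≐-sym F≐G))) , ⊑-intro (⊆ₜ⇒⊆ (≐⇒⊆ₜ F≐G))

≃⇒≐ : {F G : Face n} → F ≃ G → ts F ≐ ts G
≃⇒≐ (⊑-intro G⊆F , ⊑-intro F⊆G) = ⊆ₜ-antisym (⊆⇒⊆ₜ F⊆G) (⊆⇒⊆ₜ G⊆F)

-- Facets

ι : Bool → ℚ
ι true  = 1ℚ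
ι false = 0ℚ

ι-+-nonneg : ∀ p q → 0ℚ ≤ℚ ι p + ι q
ι-+-nonneg true  true  = decide-≤ _
ι-+-nonneg true  false = decide-≤ _
ι-+-nonneg false true  = decide-≤ _
ι-+-nonneg false false = decide-≤ _

ι-+-zero : ∀ p q → ι p + ι q ≡ 0ℚ → p ≡ false × q ≡ false
ι-+-zero false false _ = refl , refl
ι-+-zero true  true  ()
ι-+-zero true  false ()
ι-+-zero false true  ()

-- Σ_{i ≠ a} R^(i) + Σ_{j ≠ b} C^(j): only x_ab ≥ 0 is tight.
nonnegPoint : Fin n → Fin n → Mat n
nonnegPoint a b i j = ι (distinct i a) + ι (distinct j b)

slack-nonnegPoint : (a b i j k : Fin n) →
                    slack (nonnegPoint a b) (triangle i j k) ≡ ι (distinct j a) + ι (distinct j b)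
slack-nonnegPoint a b i j k =
  solve 4 (λ p q r s → ((p :+ q) :+ (r :+ s)) :- (p :+ s) := r :+ q) refl
        (ι (distinct i a)) (ι (distinct j b)) (ι (distinct j a)) (ι (distinct k b))
  where open +-*-Solver

nonnegPoint-slack≥0 : (a b : Fin n) (e : Ineq n) → 0ℚ ≤ℚ slack (nonnegPoint a b) e
nonnegPoint-slack≥0 a b (triangle i j k) =
  subst (0ℚ ≤ℚ_) (sym (slack-nonnegPoint a b i j k)) (ι-+-nonneg (distinct j a) (distinct j b))
nonnegPoint-slack≥0 a b (nonneg i j) = ι-+-nonneg (distinct i a) (distinct j b)

nonnegPoint-tight : {a b : Fin n} → a ≢ b → {e : Ineq n} → e ∈ eqSet (nonnegPoint a b) → e ≡ nonneg a b
nonnegPoint-tight {a = a} {b} a≢b {triangle i j k} e∈ =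
  ⊥-elim (a≢b (trans (sym (distinct-false (proj₁ j≡a∧j≡b))) (distinct-false (proj₂ j≡a∧j≡b))))
  where
  j≡a∧j≡b : distinct j a ≡ false × distinct j b ≡ false
  j≡a∧j≡b = ι-+-zero (distinct j a) (distinct j b)
                     (trans (sym (slack-nonnegPoint a b i j k)) (proj₂ (∈-eqSet⁻ e∈)))
nonnegPoint-tight {a = a} {b} a≢b {nonneg i j} e∈ =
  cong₂ nonneg (distinct-false (proj₁ i≡a∧j≡b)) (distinct-false (proj₂ i≡a∧j≡b))
  where
  i≡a∧j≡b : distinct i a ≡ false × distinct j b ≡ false
  i≡a∧j≡b = ι-+-zero (distinct i a) (distinct j b) (proj₂ (∈-eqSet⁻ e∈))

nonneg∈nonnegPoint : {a b : Fin n} → a ≢ b → nonneg a b ∈ eqSet (nonnegPoint a b)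
nonneg∈nonnegPoint {a = a} {b} a≢b =
  ∈-eqSet⁺ a≢b (cong₂ (λ p q → ι p + ι q) (distinct-refl a) (distinct-refl b))

arcWeight : Bool → ℚ
arcWeight true  = 1ℚ
arcWeight false = 1ℚ + 1ℚ

arcWeight-≢0 : ∀ p → arcWeight p ≢ 0ℚ
arcWeight-≢0 true  ()
arcWeight-≢0 false ()

arcWeight-slack≥0 : ∀ p q r → 0ℚ ≤ℚ (arcWeight p + arcWeight q) - arcWeight r
arcWeight-slack≥0 true  true  true  = decide-≤ _
arcWeight-slack≥0 true  true  false = decide-≤ _
arcWeight-slack≥0 true  false true  = decide-≤ _
arcWeight-slack≥0 true  false false = decide-≤ _
arcWeight-slack≥0 false true  true  = decide-≤ _
arcWeight-slack≥0 false true  false = decide-≤ _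
arcWeight-slack≥0 false false true  = decide-≤ _
arcWeight-slack≥0 false false false = decide-≤ _

arcWeight-slack≡0 : ∀ p q r → (arcWeight p + arcWeight q) - arcWeight r ≡ 0ℚ → p ≡ true × q ≡ true
arcWeight-slack≡0 true  true  _     _  = refl , refl
arcWeight-slack≡0 true  false true  ()
arcWeight-slack≡0 true  false false ()
arcWeight-slack≡0 false true  true  ()
arcWeight-slack≡0 false true  false ()
arcWeight-slack≡0 false false true  ()
arcWeight-slack≡0 false false false ()

isPair : Fin n → Fin n → Fin n → Fin n → Bool
isPair a b i j = ⌊ i F.≟ a ⌋ ∧ ⌊ j F.≟ b ⌋

isPair-true : {a b i j : Fin n} → isPair a b i j ≡ true → i ≡ a × j ≡ b
isPair-true {a = a} {b} {i} {j} p with i≡a , j≡b ← ∧-true ⌊ i F.≟ a ⌋ p =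
  isYes⇒ (i F.≟ a) i≡a , isYes⇒ (j F.≟ b) j≡b

isArc : Fin n → Fin n → Fin n → Fin n → Fin n → Bool
isArc a b c i j = isPair a b i j ∨ isPair b c i j

-- Weight 1 on the arcs ab and bc, weight 2 elsewhere: only x_ab + x_bc ≥ x_ac is tight.
trianglePoint : Fin n → Fin n → Fin n → Mat n
trianglePoint a b c i j = arcWeight (isArc a b c i j)

isArc-true : {a b c i j : Fin n} → isArc a b c i j ≡ true → (i ≡ a × j ≡ b) ⊎ (i ≡ b × j ≡ c)
isArc-true {a = a} {b} {c} {i} {j} p with ∨-true (isPair a b i j) p
... | inj₁ ab = inj₁ (isPair-true ab)
... | inj₂ bc = inj₂ (isPair-true bc)

arcs-compose : {a b c i j k : Fin n} → a ≢ b → b ≢ c → a ≢ c →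
               (i ≡ a × j ≡ b) ⊎ (i ≡ b × j ≡ c) → (j ≡ a × k ≡ b) ⊎ (j ≡ b × k ≡ c) →
               triangle i j k ≡ triangle a b c
arcs-compose a≢b _   _   (inj₁ (refl , refl)) (inj₁ (b≡a , _))  = ⊥-elim (a≢b (sym b≡a))
arcs-compose _   _   _   (inj₁ (refl , refl)) (inj₂ (_ , refl)) = refl
arcs-compose _   _   a≢c (inj₂ (refl , refl)) (inj₁ (c≡a , _))  = ⊥-elim (a≢c (sym c≡a))
arcs-compose _   b≢c _   (inj₂ (refl , refl)) (inj₂ (c≡b , _))  = ⊥-elim (b≢c (sym c≡b))

trianglePoint-tight : {a b c : Fin n} → Valid (triangle a b c) →
                      {e : Ineq n} → e ∈ eqSet (trianglePoint a b c) → e ≡ triangle a b c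
trianglePoint-tight {a = a} {b} {c} (a≢b , b≢c , a≢c) {triangle i j k} e∈ =
  arcs-compose a≢b b≢c a≢c (isArc-true (proj₁ arcs)) (isArc-true (proj₂ arcs))
  where
  arcs : isArc a b c i j ≡ true × isArc a b c j k ≡ true
  arcs = arcWeight-slack≡0 (isArc a b c i j) (isArc a b c j k) (isArc a b c i k) (proj₂ (∈-eqSet⁻ e∈))
trianglePoint-tight {a = a} {b} {c} _ {nonneg i j} e∈ =
  ⊥-elim (arcWeight-≢0 (isArc a b c i j) (proj₂ (∈-eqSet⁻ e∈)))

triangle∈trianglePoint : {a b c : Fin n} → (v : Valid (triangle a b c)) →
                         triangle a b c ∈ eqSet (trianglePoint a b c)
triangle∈trianglePoint {a = a} {b} {c} v@(a≢b , b≢c , a≢c) = ∈-eqSet⁺ {x = trianglePoint a b c} v tight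
  where
  tight : slack (trianglePoint a b c) (triangle a b c) ≡ 0ℚ
  tight rewrite isYes⇐ (a F.≟ a) refl | isYes⇐ (b F.≟ b) refl | isYes⇐ (c F.≟ c) refl
              | isNo⇐ (b F.≟ a) (a≢b ∘ sym) | isNo⇐ (c F.≟ b) (b≢c ∘ sym) | isNo⇐ (a F.≟ b) a≢b = refl

facetPoint : Ineq n → Mat n
facetPoint (triangle a b c) = trianglePoint a b c
facetPoint (nonneg a b)     = nonnegPoint a b

facetPoint-inCone : (e : Ineq n) → InCone (facetPoint e)
facetPoint-inCone (triangle a b c) = inCone slack≥0
  where
  slack≥0 : ∀ {e} → Valid e → 0ℚ ≤ℚ slack (trianglePoint a b c) e
  slack≥0 {triangle i j k} _ = arcWeight-slack≥0 (isArc a b c i j) (isArc a b c j k) (isArc a b c i k)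
  slack≥0 {nonneg i j} _ with isArc a b c i j
  ... | true  = decide-≤ _
  ... | false = decide-≤ _
facetPoint-inCone (nonneg a b) = inCone (λ {e} _ → nonnegPoint-slack≥0 a b e)

facet : Ineq n → Face n
facet e = face (facetPoint e) (facetPoint-inCone e)

facet-∋ : {e : Ineq n} → Valid e → e ∈ ts (facet e)
facet-∋ {e = triangle a b c} v = triangle∈trianglePoint v
facet-∋ {e = nonneg a b}     v = nonneg∈nonnegPoint v

∈-facet : {e e′ : Ineq n} → Valid e → e′ ∈ ts (facet e) → e′ ≡ e
∈-facet {e = triangle a b c} v = trianglePoint-tight v
∈-facet {e = nonneg a b}     v = nonnegPoint-tight v

∈⇔⊑facet : {F : Face n} {e : Ineq n} → Valid e → e ∈ ts F ⇔ F ⊑ facet e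
∈⇔⊑facet {F = F} ve = mk⇔
  (λ e∈F → ⊑-intro (λ e′∈ → subst (_∈ ts F) (sym (∈-facet ve e′∈)) e∈F))
  (λ F⊑facet → ts-⊇ F⊑facet (facet-∋ ve))

whole-⋢-facet : {e : Ineq n} → Valid e → ¬ whole ⊑ facet e
whole-⋢-facet ve whole⊑facet = ∉-whole (ts-⊇ whole⊑facet (facet-∋ ve))

facet-isCoatom : {e : Ineq n} → Valid e → IsCoatom whole (facet e)
facet-isCoatom {e = e} ve = whole-⋢-facet ve , split
  where
  split : ∀ G → facet e ⊑ G → whole ⊑ G ⊎ G ⊑ facet e
  split G (⊑-intro G⊆facet) = split′ (e ∈? ts G)
    where
    split′ : Dec (e ∈ ts G) → whole ⊑ G ⊎ G ⊑ facet e
    split′ (yes e∈G) = inj₂ (⊑-intro (λ e′∈ → subst (_∈ ts G) (sym (∈-facet ve e′∈)) e∈G))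
    split′ (no e∉G)  = inj₁ (⊑-intro (λ e′∈ → ⊥-elim (e∉G (subst (_∈ ts G) (∈-facet ve (G⊆facet e′∈)) e′∈))))

coatom-isFacet : {F : Face n} → IsCoatom whole F → ∃ λ e → Valid e × F ≃ facet e
coatom-isFacet {F = F} (whole⋢F , split) = from-member (member? (ts F))
  where
  from-member : Dec (∃ λ e → e ∈ ts F) → ∃ λ e → Valid e × F ≃ facet e
  from-member (no none) = ⊥-elim (whole⋢F (⊑-intro (λ e∈ → ⊥-elim (none (_ , e∈)))))
  from-member (yes (e , e∈F)) =
    e , ve , F⊑facet , Sum.[ ⊥-elim ∘ whole-⋢-facet ve , id ]′ (split (facet e) F⊑facet)
    where
    ve : Valid e
    ve = ts-valid F e∈F
    F⊑facet : F ⊑ facet e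
    F⊑facet = Equivalence.to (∈⇔⊑facet ve) e∈F

-- The rays R^(a) and C^(a)

data Line : Set where
  row col : Line

pairKey : Line → Fin n → Fin n → Fin n
pairKey row i j = i
pairKey col i j = j

key : Line → Ineq n → Fin n
key _ (triangle i j k) = j
key X (nonneg i j)     = pairKey X i j

lineMat : Line → (Fin n → ℚ) → Mat n
lineMat X f i j = f (pairKey X i j)

slack-lineMat : ∀ X (f : Fin n → ℚ) e → slack (lineMat X f) e ≡ f (key X e)
slack-lineMat row f (triangle i j k) = solve 2 (λ p q → (p :+ q) :- p := q) refl (f i) (f j)
  where open +-*-Solver
slack-lineMat col f (triangle i j k) = solve 2 (λ p q → (p :+ q) :- q := p) refl (f j) (f k)
  where open +-*-Solver
slack-lineMat X   f (nonneg i j)     = refl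

spike : ℚ → Fin n → Fin n → ℚ
spike t a i = if ⌊ i F.≟ a ⌋ then t else 0ℚ

spike-≡ : ∀ {t} {a i : Fin n} → i ≡ a → spike t a i ≡ t
spike-≡ {a = a} {i} i≡a rewrite isYes⇐ (i F.≟ a) i≡a = refl

spike-≢ : ∀ {t} {a i : Fin n} → i ≢ a → spike t a i ≡ 0ℚ
spike-≢ {a = a} {i} i≢a rewrite isNo⇐ (i F.≟ a) i≢a = refl

spike-nonneg : ∀ {t} {a i : Fin n} → 0ℚ ≤ℚ t → 0ℚ ≤ℚ spike t a i
spike-nonneg {a = a} {i} 0≤t with ⌊ i F.≟ a ⌋
... | true  = 0≤t
... | false = ℚP.≤-refl

spike-of-0 : ∀ {t} {a i : Fin n} → t ≡ 0ℚ → spike t a i ≡ 0ℚ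
spike-of-0 {a = a} {i} t≡0 with ⌊ i F.≟ a ⌋
... | true  = t≡0
... | false = refl

L : Line → Fin n → Mat n
L row = Rm
L col = Cm

L≗lineMat : ∀ X (a : Fin n) {i j} → i ≢ j → L X a i j ≡ lineMat X (spike 1ℚ a) i j
L≗lineMat row a {i}     i≢j rewrite ≢⇒distinct i≢j | ∧-identityʳ ⌊ i F.≟ a ⌋ = refl
L≗lineMat col a {j = j} i≢j rewrite ≢⇒distinct i≢j | ∧-identityʳ ⌊ j F.≟ a ⌋ = refl

slack-L : ∀ X (a : Fin n) {e} → Valid e → slack (L X a) e ≡ spike 1ℚ a (key X e)
slack-L X a {e} ve = trans (slack-cong (L≗lineMat X a) ve) (slack-lineMat X (spike 1ℚ a) e)

L-inCone : ∀ X (a : Fin n) → InCone (L X a)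
L-inCone X a = inCone λ {e} ve →
  subst (0ℚ ≤ℚ_) (sym (slack-L X a ve)) (spike-nonneg {a = a} {key X e} (decide-≤ _))

lineFace : Line → Fin n → Face n
lineFace X a = face (L X a) (L-inCone X a)

L-∈ : ∀ X {a : Fin n} {e} → Valid e → key X e ≢ a → e ∈ eqSet (L X a)
L-∈ X {a} ve k≢a = ∈-eqSet⁺ ve (trans (slack-L X a ve) (spike-≢ k≢a))

L-∉ : ∀ X {a : Fin n} {e} → key X e ≡ a → e ∉ eqSet (L X a)
L-∉ X {a} k≡a e∈ =
  ℚP.1≢0 (trans (sym (spike-≡ k≡a)) (trans (sym (slack-L X a (proj₁ (∈-eqSet⁻ e∈)))) (proj₂ (∈-eqSet⁻ e∈))))

L-∉⇒key : ∀ X {a : Fin n} {e} → Valid e → e ∉ eqSet (L X a) → key X e ≡ a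
L-∉⇒key X {a} {e} ve e∉ = decidable-stable (key X e F.≟ a) (λ k≢a → e∉ (L-∈ X ve k≢a))

L-complementary : ∀ X {a b : Fin n} → a ≢ b → ∀ {e} → Valid e → e ∈ eqSet (L X a) ⊎ e ∈ eqSet (L X b)
L-complementary X {a} {b} a≢b {e} ve with key X e F.≟ a
... | yes k≡a = inj₂ (L-∈ X ve (λ k≡b → a≢b (trans (sym k≡a) k≡b)))
... | no k≢a  = inj₁ (L-∈ X ve k≢a)

⊆-L : ∀ X {p : Fin n} {x : Mat n} → (∀ {e} → Valid e → key X e ≡ p → e ∉ eqSet x) → eqSet x ⊆ eqSet (L X p)
⊆-L X untight e∈ = let ve = proj₁ (∈-eqSet⁻ e∈) in L-∈ X ve (λ k≡p → untight ve k≡p e∈)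

tight-off-key : ∀ X {a : Fin n} {y : Mat n} → eqSet (L X a) ⊆ eqSet y →
                ∀ {e} → Valid e → key X e ≢ a → slack y e ≡ 0ℚ
tight-off-key X L⊆y ve k≢a = proj₂ (∈-eqSet⁻ (L⊆y (L-∈ X ve k≢a)))

row-entry : {a b v : Fin n} {y : Mat n} → eqSet (L row a) ⊆ eqSet y → b ≢ a → v ≢ a → y a v ≡ y a b
row-entry {a = a} {b} {v} {y} L⊆y b≢a v≢a with v F.≟ b
... | yes refl = refl
... | no v≢b = sym (begin
  y a b          ≡⟨ sym (ℚP.+-identityʳ (y a b)) ⟩
  y a b + 0ℚ     ≡⟨ cong (y a b +_) (sym (tight-off-key row L⊆y {nonneg b v} (v≢b ∘ sym) b≢a)) ⟩
  y a b + y b v  ≡⟨ -≡0⇒≡ (tight-off-key row L⊆y {triangle a b v} (b≢a ∘ sym , v≢b ∘ sym , v≢a ∘ sym) b≢a) ⟩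
  y a v          ∎)
  where open ≡-Reasoning

col-entry : {a b u : Fin n} {y : Mat n} → eqSet (L col a) ⊆ eqSet y → b ≢ a → u ≢ a → y u a ≡ y b a
col-entry {a = a} {b} {u} {y} L⊆y b≢a u≢a with u F.≟ b
... | yes refl = refl
... | no u≢b = sym (begin
  y b a          ≡⟨ sym (ℚP.+-identityˡ (y b a)) ⟩
  0ℚ + y b a     ≡⟨ cong (_+ y b a) (sym (tight-off-key col L⊆y {nonneg u b} u≢b b≢a)) ⟩
  y u b + y b a  ≡⟨ -≡0⇒≡ (tight-off-key col L⊆y {triangle u b a} (u≢b , b≢a , u≢a) b≢a) ⟩
  y u a          ∎)
  where open ≡-Reasoning

keyedNonneg : Line → Fin n → Fin n → Ineq n
keyedNonneg row a b = nonneg a b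
keyedNonneg col a b = nonneg b a

keyedNonneg-valid : ∀ X {a b : Fin n} → b ≢ a → Valid (keyedNonneg X a b)
keyedNonneg-valid row b≢a = b≢a ∘ sym
keyedNonneg-valid col b≢a = b≢a

key-keyedNonneg : ∀ X (a b : Fin n) → key X (keyedNonneg X a b) ≡ a
key-keyedNonneg row a b = refl
key-keyedNonneg col a b = refl

entries-on-ray : ∀ X {a b : Fin n} {y : Mat n} → eqSet (L X a) ⊆ eqSet y → b ≢ a →
                 ∀ {i j} → i ≢ j → y i j ≡ lineMat X (spike (slack y (keyedNonneg X a b)) a) i j
entries-on-ray row {a} L⊆y b≢a {i} {j} i≢j with i F.≟ a
... | yes refl = row-entry L⊆y b≢a (i≢j ∘ sym)
... | no i≢a   = tight-off-key row L⊆y {nonneg i j} i≢j i≢a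
entries-on-ray col {a} L⊆y b≢a {i} {j} i≢j with j F.≟ a
... | yes refl = col-entry L⊆y b≢a i≢j
... | no j≢a   = tight-off-key col L⊆y {nonneg i j} i≢j j≢a

slack-on-ray : ∀ X {a b : Fin n} {y : Mat n} → eqSet (L X a) ⊆ eqSet y → b ≢ a →
               ∀ {e} → Valid e → slack y e ≡ spike (slack y (keyedNonneg X a b)) a (key X e)
slack-on-ray X {a} {b} {y} L⊆y b≢a {e} ve =
  trans (slack-cong (entries-on-ray X L⊆y b≢a) ve) (slack-lineMat X (spike (slack y (keyedNonneg X a b)) a) e)

lineFace-isAtom : ∀ X {a b : Fin n} → b ≢ a → IsAtom apex (lineFace X a)
lineFace-isAtom {n = n} X {a} {b} b≢a = not-apex , split
  where
  probe : Ineq n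
  probe = keyedNonneg X a b

  not-apex : ¬ lineFace X a ⊑ apex
  not-apex (⊑-intro apex⊆L) =
    L-∉ X (key-keyedNonneg X a b) (apex⊆L (∈-eqSet⁺ (keyedNonneg-valid X b≢a) (slack-constMat 0ℚ probe)))

  split : ∀ G → G ⊑ lineFace X a → G ⊑ apex ⊎ lineFace X a ⊑ G
  split G (⊑-intro L⊆G) = split′ (slack (point G) probe ℚP.≟ 0ℚ)
    where
    L⊆y : eqSet (L X a) ⊆ eqSet (point G)
    L⊆y e∈ = ts⊆eqSet G (L⊆G e∈)
    split′ : Dec (slack (point G) probe ≡ 0ℚ) → G ⊑ apex ⊎ lineFace X a ⊑ G
    split′ (yes t≡0) = inj₁ (⊑-intro (λ e∈ → let ve = ts-valid apex e∈ in
      eqSet⊆ts G (∈-eqSet⁺ ve (trans (slack-on-ray X L⊆y b≢a ve) (spike-of-0 t≡0)))))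
    split′ (no t≢0) = inj₂ (⊑-intro (λ e∈ → let ve , tight = ∈-eqSet⁻ (ts⊆eqSet G e∈) in
      L-∈ X ve (λ k≡a → t≢0 (trans (sym (spike-≡ k≡a)) (trans (sym (slack-on-ray X L⊆y b≢a ve)) tight)))))

row-⋢-col : {a b : Fin n} → b ≢ a → ¬ lineFace row a ⊑ lineFace col a
row-⋢-col b≢a (⊑-intro col⊆row) = L-∉ row refl (col⊆row (L-∈ col (b≢a ∘ sym) b≢a))

≡-from-two-keys : ∀ X Y {e₁ e₂ : Ineq n} {a b} → e₁ ≢ e₂ →
                  key X e₁ ≡ a → key Y e₁ ≡ b → key X e₂ ≡ a → key Y e₂ ≡ b → a ≡ b
≡-from-two-keys X   Y   {triangle _ _ _} _ refl refl _ _ = refl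
≡-from-two-keys X   Y   {nonneg _ _} {triangle _ _ _} _ _ _ refl refl = refl
≡-from-two-keys row row {nonneg _ _} {nonneg _ _} _ refl refl _ _ = refl
≡-from-two-keys col col {nonneg _ _} {nonneg _ _} _ refl refl _ _ = refl
≡-from-two-keys row col {nonneg _ _} {nonneg _ _} e₁≢e₂ refl refl refl refl = ⊥-elim (e₁≢e₂ refl)
≡-from-two-keys col row {nonneg _ _} {nonneg _ _} e₁≢e₂ refl refl refl refl = ⊥-elim (e₁≢e₂ refl)

-- Families of points with complementary equality sets

module ComplementaryFamily {n : ℕ} {K : Set} (_≟ᴷ_ : DecidableEquality K)
  {k₀ k₁ k₂ : K} (k₀≢k₁ : k₀ ≢ k₁) (k₀≢k₂ : k₀ ≢ k₂) (k₁≢k₂ : k₁ ≢ k₂)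
  (x : K → Mat n) (x-inCone : ∀ k → InCone (x k))
  (complementary : ∀ {k l} → k ≢ l → ∀ {e} → Valid e → e ∈ eqSet (x k) ⊎ e ∈ eqSet (x l))
  (covering : ∀ {e} → Valid e → ∃ λ k → e ∉ eqSet (x k))
  (nonzero : ∀ k → ∃₂ λ u v → u ≢ v × x k u v ≢ 0ℚ) where

  -- The unique k with x k u v ≢ 0ℚ; the value k₀ on the diagonal is junk.
  owner : Fin n → Fin n → K
  owner u v with u F.≟ v
  ... | yes _   = k₀
  ... | no u≢v = proj₁ (covering {nonneg u v} u≢v)

  owner-nonzero : ∀ {u v} → u ≢ v → x (owner u v) u v ≢ 0ℚ
  owner-nonzero {u} {v} u≢v with u F.≟ v
  ... | yes u≡v  = ⊥-elim (u≢v u≡v)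
  ... | no u≢v′ = λ x≡0 → proj₂ (covering {nonneg u v} u≢v′) (∈-eqSet⁺ u≢v′ x≡0)

  owned-nonzero : ∀ {u v k} → u ≢ v → owner u v ≡ k → x k u v ≢ 0ℚ
  owned-nonzero u≢v refl = owner-nonzero u≢v

  nonowner-zero : ∀ {u v k} → u ≢ v → owner u v ≢ k → x k u v ≡ 0ℚ
  nonowner-zero u≢v o≢k = Sum.[ (λ ∈owner → ⊥-elim (owner-nonzero u≢v (proj₂ (∈-eqSet⁻ ∈owner))))
                              , (λ ∈k → proj₂ (∈-eqSet⁻ ∈k)) ] (complementary o≢k {nonneg _ _} u≢v)

  owner-unique : ∀ {u v k} → u ≢ v → x k u v ≢ 0ℚ → owner u v ≡ k
  owner-unique {u} {v} {k} u≢v x≢0 = decidable-stable (owner u v ≟ᴷ k) (λ o≢k → x≢0 (nonowner-zero u≢v o≢k))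

  owner-detour : ∀ {a b c} → a ≢ b → b ≢ c → a ≢ c → owner a c ≡ owner a b ⊎ owner a c ≡ owner b c
  owner-detour {a} {b} {c} a≢b b≢c a≢c with owner a c ≟ᴷ owner a b | owner a c ≟ᴷ owner b c
  ... | yes ac≡ab | _         = inj₁ ac≡ab
  ... | no _      | yes ac≡bc = inj₂ ac≡bc
  ... | no ac≢ab  | no ac≢bc  =
    ⊥-elim (owner-nonzero a≢c (0≤z∧0≤-z⇒z≡0 (slack-nonneg (x-inCone k) {nonneg a c} a≢c)
                                            (subst (0ℚ ≤ℚ_) (ℚP.+-identityˡ _) slack≥0)))
    where
    k : K
    k = owner a c
    slack≥0 : 0ℚ ≤ℚ (0ℚ + 0ℚ) - x k a c
    slack≥0 = subst (λ s → 0ℚ ≤ℚ s - x k a c)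
                    (cong₂ _+_ (nonowner-zero a≢b (ac≢ab ∘ sym)) (nonowner-zero b≢c (ac≢bc ∘ sym)))
                    (slack-nonneg (x-inCone k) {triangle a b c} (a≢b , b≢c , a≢c))

  owner-onto : ∀ k → ∃₂ λ u v → u ≢ v × owner u v ≡ k
  owner-onto k = let u , v , u≢v , x≢0 = nonzero k in u , v , u≢v , owner-unique u≢v x≢0

  owner-not-two-coloured : ∀ α β → ¬ (∀ {u v} → u ≢ v → owner u v ≡ α ⊎ owner u v ≡ β)
  owner-not-two-coloured α β two = pigeonhole (coloured k₀) (coloured k₁) (coloured k₂)
    where
    coloured : ∀ k → k ≡ α ⊎ k ≡ β
    coloured k = let u , v , u≢v , o≡k = owner-onto k in subst (λ c → c ≡ α ⊎ c ≡ β) o≡k (two u≢v)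
    pigeonhole : k₀ ≡ α ⊎ k₀ ≡ β → k₁ ≡ α ⊎ k₁ ≡ β → k₂ ≡ α ⊎ k₂ ≡ β → ⊥
    pigeonhole (inj₁ refl) (inj₁ k₁≡α) _ = k₀≢k₁ (sym k₁≡α)
    pigeonhole (inj₂ refl) (inj₂ k₁≡β) _ = k₀≢k₁ (sym k₁≡β)
    pigeonhole (inj₁ refl) _ (inj₁ k₂≡α) = k₀≢k₂ (sym k₂≡α)
    pigeonhole (inj₂ refl) _ (inj₂ k₂≡β) = k₀≢k₂ (sym k₂≡β)
    pigeonhole _ (inj₁ refl) (inj₁ k₂≡α) = k₁≢k₂ (sym k₂≡α)
    pigeonhole _ (inj₂ refl) (inj₂ k₂≡β) = k₁≢k₂ (sym k₂≡β)

  triangle-untight : ∀ {u v w k} → Valid (triangle u v w) → owner u v ≡ k ⊎ owner v w ≡ k →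
                     (owner u w ≡ k → owner u v ≡ k × owner v w ≡ k) → triangle u v w ∉ eqSet (x k)
  triangle-untight {u} {v} {w} {k} vt@(u≢v , v≢w , u≢w) some-k all-k tight with owner u w ≟ᴷ k
  ... | no uw≢k =
    Sum.[ (λ uv≡k → owned-nonzero u≢v uv≡k uv≡0) , (λ vw≡k → owned-nonzero v≢w vw≡k vw≡0) ]′ some-k
    where
    sum≡0 : x k u v + x k v w ≡ 0ℚ
    sum≡0 = trans (sym (ℚP.+-identityʳ _))
                  (trans (cong (λ s → (x k u v + x k v w) - s) (sym (nonowner-zero u≢w uw≢k)))
                         (proj₂ (∈-eqSet⁻ tight)))
    uv≥0 : 0ℚ ≤ℚ x k u v
    uv≥0 = slack-nonneg (x-inCone k) {nonneg u v} u≢v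
    vw≥0 : 0ℚ ≤ℚ x k v w
    vw≥0 = slack-nonneg (x-inCone k) {nonneg v w} v≢w
    uv≡0 : x k u v ≡ 0ℚ
    uv≡0 = nonneg-+-zeroˡ uv≥0 vw≥0 sum≡0
    vw≡0 : x k v w ≡ 0ℚ
    vw≡0 = nonneg-+-zeroʳ uv≥0 vw≥0 sum≡0
  ... | yes uw≡k with covering vt
  ...   | m , untight-m with k ≟ᴷ m
  ...     | yes refl = untight-m tight
  ...     | no k≢m   = untight-m (∈-eqSet⁺ vt slack≡0)
    where
    zero-at : ∀ {i j} → i ≢ j → owner i j ≡ k → x m i j ≡ 0ℚ
    zero-at i≢j ij≡k = nonowner-zero i≢j (k≢m ∘ trans (sym ij≡k))
    slack≡0 : slack (x m) (triangle u v w) ≡ 0ℚ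
    slack≡0 = trans (cong₂ _-_ (cong₂ _+_ (zero-at u≢v (proj₁ (all-k uw≡k))) (zero-at v≢w (proj₂ (all-k uw≡k))))
                               (zero-at u≢w uw≡k)) refl

  row-untight : RowConstant owner → ∀ {p q k} → p ≢ q → owner p q ≡ k →
                ∀ {e} → Valid e → key row e ≡ p → e ∉ eqSet (x k)
  row-untight rows {p} {q} p≢q pq≡k {nonneg .p v} p≢v refl e∈ =
    owned-nonzero p≢v (trans (rows p≢v p≢q) pq≡k) (proj₂ (∈-eqSet⁻ e∈))
  row-untight rows {p} {q} {k} p≢q pq≡k {triangle u .p w} vt@(u≢p , p≢w , u≢w) refl =
    triangle-untight vt (inj₂ pw≡k) (λ uw≡k → trans (rows u≢p u≢w) uw≡k , pw≡k)
    where
    pw≡k : owner p w ≡ k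
    pw≡k = trans (rows p≢w p≢q) pq≡k

  column-untight : ColumnConstant owner → ∀ {p q k} → p ≢ q → owner p q ≡ k →
                   ∀ {e} → Valid e → key col e ≡ q → e ∉ eqSet (x k)
  column-untight cols {p} {q} p≢q pq≡k {nonneg u .q} u≢q refl e∈ =
    owned-nonzero u≢q (trans (cols u≢q p≢q) pq≡k) (proj₂ (∈-eqSet⁻ e∈))
  column-untight cols {p} {q} {k} p≢q pq≡k {triangle u .q w} vt@(u≢q , q≢w , u≢w) refl =
    triangle-untight vt (inj₁ uq≡k) (λ uw≡k → uq≡k , trans (cols q≢w u≢w) uw≡k)
    where
    uq≡k : owner u q ≡ k
    uq≡k = trans (cols u≢q p≢q) pq≡k

  line-family : ∃ λ X → ∀ k → ∃ λ j → eqSet (x k) ⊆ eqSet (L X j)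
  line-family with classify _≟ᴷ_ owner owner-detour owner-not-two-coloured
  ... | inj₁ rows = row , λ k →
    let p , q , p≢q , pq≡k = owner-onto k in p , ⊆-L row (row-untight rows p≢q pq≡k)
  ... | inj₂ cols = col , λ k →
    let p , q , p≢q , pq≡k = owner-onto k in q , ⊆-L col (column-untight cols p≢q pq≡k)

-- Combinatorial automorphisms

module FaceAutomorphism {n : ℕ} (φ : Face n → Face n) (aut : IsCombAut φ) where

  φ-mono : {F G : Face n} → F ⊑ G → φ F ⊑ φ G
  φ-mono {F} {G} (⊑-intro G⊆F) = ⊑-intro (⊆ₜ⇒⊆ (proj₁ aut G F (⊆⇒⊆ₜ G⊆F)))

  φ-reflect : {F G : Face n} → φ F ⊑ φ G → F ⊑ G
  φ-reflect {F} {G} (⊑-intro φG⊆φF) = ⊑-intro (⊆ₜ⇒⊆ (proj₁ (proj₂ aut) G F (⊆⇒⊆ₜ φG⊆φF)))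

  φ-onto : ∀ G → ∃ λ F → φ F ≃ G
  φ-onto G = let F , φF≐G = proj₂ (proj₂ aut) G in F , ≐⇒≃ φF≐G

  φ-≃ : {F G : Face n} → F ≃ G → φ F ≃ φ G
  φ-≃ (F⊑G , G⊑F) = φ-mono F⊑G , φ-mono G⊑F

  open Automorphism φ φ-mono φ-reflect φ-onto public using (φ-atom)
  open CoatomAutomorphism φ φ-mono φ-reflect (Product.map₂ swap ∘ φ-onto)
    using () renaming (φ-atom to φ-coatom; φ-atom⁻ to φ-coatom⁻)

  Transfers : Ineq n → Ineq n → Set
  Transfers e e′ = ∀ F → e ∈ ts F ⇔ e′ ∈ ts (φ F)

  transfers : {e e′ : Ineq n} → Valid e → Valid e′ → φ (facet e) ≃ facet e′ → Transfers e e′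
  transfers ve ve′ (φfacet⊑ , ⊑φfacet) F = mk⇔
    (λ e∈F → from (∈⇔⊑facet ve′) (⊑-trans (φ-mono (to (∈⇔⊑facet ve) e∈F)) φfacet⊑))
    (λ e′∈φF → from (∈⇔⊑facet ve) (φ-reflect (⊑-trans (to (∈⇔⊑facet ve′) e′∈φF) ⊑φfacet)))
    where open Equivalence

  facet-image : {e : Ineq n} → Valid e → ∃ λ e′ → Valid e′ × Transfers e e′
  facet-image ve =
    let e′ , ve′ , φfacet≃facet = coatom-isFacet (φ-coatom whole-greatest (facet-isCoatom ve))
    in e′ , ve′ , transfers ve ve′ φfacet≃facet

  facet-preimage : {e′ : Ineq n} → Valid e′ → ∃ λ e → Valid e × Transfers e e′
  facet-preimage ve′ =
    let K , K-coatom , φK≃facet = φ-coatom⁻ whole-greatest (facet-isCoatom ve′)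
        e , ve , K≃facet = coatom-isFacet K-coatom
    in e , ve , transfers ve ve′ (≃-trans (φ-≃ (swap K≃facet)) (swap φK≃facet))

  transfer-injective : {e₁ e₁′ e₂ e₂′ : Ineq n} → Valid e₁ → Transfers e₁ e₁′ → Transfers e₂ e₂′ →
                       e₁′ ≡ e₂′ → e₂ ≡ e₁
  transfer-injective {e₁ = e₁} v₁ t₁ t₂ refl =
    ∈-facet v₁ (Equivalence.from (t₂ (facet e₁)) (Equivalence.to (t₁ (facet e₁)) (facet-∋ v₁)))

  lineImage : Line → Fin n → Face n
  lineImage X k = φ (lineFace X k)

  lineImage-complementary : ∀ X {k l} → k ≢ l →
                            ∀ {e′} → Valid e′ → e′ ∈ ts (lineImage X k) ⊎ e′ ∈ ts (lineImage X l)
  lineImage-complementary X k≢l ve′ =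
    let e , ve , t = facet-preimage ve′
    in Sum.map (Equivalence.to (t _)) (Equivalence.to (t _)) (L-complementary X k≢l ve)

  lineImage-covering : ∀ X {e′} → Valid e′ → ∃ λ k → e′ ∉ ts (lineImage X k)
  lineImage-covering X ve′ =
    let e , ve , t = facet-preimage ve′
    in key X e , λ e′∈ → L-∉ X refl (Equivalence.from (t _) e′∈)

  image-key : ∀ X i Y a {e e′ : Ineq n} → lineImage X i ⊑ lineFace Y a → Valid e′ → Transfers e e′ →
              key X e ≡ i → key Y e′ ≡ a
  image-key X i Y a img⊑ ve′ t k≡i =
    L-∉⇒key Y ve′ (λ e′∈ → L-∉ X k≡i (Equivalence.from (t (lineFace X i)) (ts-⊇ img⊑ e′∈)))

  sends : ∀ X i Y j → lineImage X i ≃ lineFace Y j → Sends φ (L X i) (L Y j)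
  sends X i Y j img≃ F F≐ = ≃⇒≐ (≃-trans (φ-≃ (≐⇒≃ F≐)) img≃)

-- Images of the rays

module RayImages {m : ℕ} (φ : Face (3 ℕ.+ m) → Face (3 ℕ.+ m)) (aut : IsCombAut φ) where

  open FaceAutomorphism φ aut

  two-others : (i : Fin (3 ℕ.+ m)) → ∃₂ λ p q → p ≢ i × q ≢ i × p ≢ q
  two-others F.zero             = F.suc F.zero , F.suc (F.suc F.zero) , (λ ()) , (λ ()) , (λ ())
  two-others (F.suc F.zero)     = F.zero , F.suc (F.suc F.zero) , (λ ()) , (λ ()) , (λ ())
  two-others (F.suc (F.suc _))  = F.zero , F.suc F.zero , (λ ()) , (λ ()) , (λ ())

  other≢ : (i : Fin (3 ℕ.+ m)) → proj₁ (two-others i) ≢ i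
  other≢ i = proj₁ (proj₂ (proj₂ (two-others i)))

  lineImage-isAtom : ∀ X k → IsAtom apex (lineImage X k)
  lineImage-isAtom X k = φ-atom apex-least (lineFace-isAtom X (other≢ k))

  lineImage-family : ∀ X → ∃ λ Y → ∀ k → ∃ λ j → eqSet (point (lineImage X k)) ⊆ eqSet (L Y j)
  lineImage-family X = ComplementaryFamily.line-family F._≟_
    {k₀ = F.zero} {F.suc F.zero} {F.suc (F.suc F.zero)} (λ ()) (λ ()) (λ ())
    x (point-inCone ∘ lineImage X) complementary covering nonzero
    where
    x : Fin (3 ℕ.+ m) → Mat (3 ℕ.+ m)
    x k = point (lineImage X k)
    complementary : ∀ {k l} → k ≢ l → ∀ {e} → Valid e → e ∈ eqSet (x k) ⊎ e ∈ eqSet (x l)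
    complementary {k} {l} k≢l ve =
      Sum.map (ts⊆eqSet (lineImage X k)) (ts⊆eqSet (lineImage X l)) (lineImage-complementary X k≢l ve)
    covering : ∀ {e} → Valid e → ∃ λ k → e ∉ eqSet (x k)
    covering ve = let k , e∉ = lineImage-covering X ve in k , λ e∈ → e∉ (eqSet⊆ts (lineImage X k) e∈)
    nonzero : ∀ k → ∃₂ λ u v → u ≢ v × x k u v ≢ 0ℚ
    nonzero k = nonzero-entry (lineImage X k) (proj₁ (lineImage-isAtom X k))

  lineImage-isLine : ∀ X → ∃ λ Y → ∀ k → ∃ λ j → lineImage X k ≃ lineFace Y j
  lineImage-isLine X = Product.map₂ (λ {Y} family k → Product.map₂ (atom-≃ k Y) (family k)) (lineImage-family X)
    where
    atom-≃ : ∀ k Y {j} → eqSet (point (lineImage X k)) ⊆ eqSet (L Y j) → lineImage X k ≃ lineFace Y j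
    atom-≃ k Y {j} ⊆L = Sum.[ ⊥-elim ∘ L⋢apex , (λ img⊑L → img⊑L , L⊑img) ]′ split
      where
      L⊑img : lineFace Y j ⊑ lineImage X k
      L⊑img = ⊑-intro (λ e∈ → ⊆L (ts⊆eqSet (lineImage X k) e∈))
      L⋢apex : ¬ lineFace Y j ⊑ apex
      L⋢apex = proj₁ (lineFace-isAtom Y (other≢ j))
      split : lineFace Y j ⊑ apex ⊎ lineImage X k ⊑ lineFace Y j
      split = proj₂ (lineImage-isAtom X k) (lineFace Y j) L⊑img

  -- Both R^(i) and C^(i) are non-tight on the triangle inequalities for p, i, q and for q, i, p.
  indices-agree : ∀ i X a Y b → lineImage row i ⊑ lineFace X a → lineImage col i ⊑ lineFace Y b →
                  (∃₂ λ p q → p ≢ i × q ≢ i × p ≢ q) → a ≡ b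
  indices-agree i X a Y b rowImg⊑ colImg⊑ (p , q , p≢i , q≢i , p≢q) =
    from-images (facet-image v₁) (facet-image v₂)
    where
    v₁ : Valid (triangle p i q)
    v₁ = p≢i , q≢i ∘ sym , p≢q
    v₂ : Valid (triangle q i p)
    v₂ = q≢i , p≢i ∘ sym , p≢q ∘ sym
    from-images : (∃ λ e₁′ → Valid e₁′ × Transfers (triangle p i q) e₁′) →
                  (∃ λ e₂′ → Valid e₂′ × Transfers (triangle q i p) e₂′) → a ≡ b
    from-images (e₁′ , v₁′ , t₁) (e₂′ , v₂′ , t₂) =
      ≡-from-two-keys X Y (λ e₁′≡e₂′ → p≢q (sym (triangle-injectiveˡ (transfer-injective v₁ t₁ t₂ e₁′≡e₂′))))
        (image-key row i X a rowImg⊑ v₁′ t₁ refl) (image-key col i Y b colImg⊑ v₁′ t₁ refl)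
        (image-key row i X a rowImg⊑ v₂′ t₂ refl) (image-key col i Y b colImg⊑ v₂′ t₂ refl)

  paired : ∀ i X a Y b → lineImage row i ≃ lineFace X a → lineImage col i ≃ lineFace Y b → a ≡ b × X ≢ Y
  paired i X a Y b rowImg≃ colImg≃ = a≡b , X≢Y
    where
    a≡b : a ≡ b
    a≡b = indices-agree i X a Y b (proj₁ rowImg≃) (proj₁ colImg≃) (two-others i)
    X≢Y : X ≢ Y
    X≢Y refl = row-⋢-col (other≢ i) (φ-reflect (proj₁ (≃-trans rowImg≃ (swap colImg≃′))))
      where
      colImg≃′ : lineImage col i ≃ lineFace X a
      colImg≃′ = subst (λ b → lineImage col i ≃ lineFace X b) (sym a≡b) colImg≃

  blocks : ∃₂ λ X Y → X ≢ Y × ∀ i → ∃ λ j → lineImage row i ≃ lineFace X j × lineImage col i ≃ lineFace Y j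
  blocks = combine (lineImage-isLine row) (lineImage-isLine col)
    where
    combine : (∃ λ X → ∀ k → ∃ λ j → lineImage row k ≃ lineFace X j) →
              (∃ λ Y → ∀ k → ∃ λ j → lineImage col k ≃ lineFace Y j) →
              ∃₂ λ X Y → X ≢ Y × ∀ i → ∃ λ j → lineImage row i ≃ lineFace X j × lineImage col i ≃ lineFace Y j
    combine (X , rows) (Y , cols) = X , Y , proj₂ (paired-at F.zero) , λ i →
      proj₁ (rows i) , proj₂ (rows i) ,
      subst (λ j → lineImage col i ≃ lineFace Y j) (sym (proj₁ (paired-at i))) (proj₂ (cols i))
      where
      paired-at : ∀ i → proj₁ (rows i) ≡ proj₁ (cols i) × X ≢ Y
      paired-at i = paired i X (proj₁ (rows i)) Y (proj₁ (cols i)) (proj₂ (rows i)) (proj₂ (cols i))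

  block-sends : ∀ X Y → (∀ i → ∃ λ j → lineImage row i ≃ lineFace X j × lineImage col i ≃ lineFace Y j) →
                ∀ i → ∃ λ j → Sends φ (Rm i) (L X j) × Sends φ (Cm i) (L Y j)
  block-sends X Y pairs i =
    let j , rowImg≃ , colImg≃ = pairs i in j , sends row i X j rowImg≃ , sends col i Y j colImg≃

mainTheorem9 : (n : ℕ) → 3 ≤ n → (φ : Face n → Face n) → IsCombAut φ →
    (((∀ (i : Fin n) → ∃ λ j → Sends φ (Rm i) (Rm j))
        × (∀ (i : Fin n) → ∃ λ j → Sends φ (Cm i) (Cm j)))
      ⊎ ((∀ (i : Fin n) → ∃ λ j → Sends φ (Rm i) (Cm j))
        × (∀ (i : Fin n) → ∃ λ j → Sends φ (Cm i) (Rm j))))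
    × (∀ (i : Fin n) → ∃ λ j →
        (Sends φ (Rm i) (Rm j) × Sends φ (Cm i) (Cm j))
        ⊎ (Sends φ (Rm i) (Cm j) × Sends φ (Cm i) (Rm j)))
mainTheorem9 (suc (suc (suc m))) (s≤s (s≤s (s≤s z≤n))) φ aut = case RayImages.blocks φ aut of λ where
  (row , row , X≢Y , _)     → ⊥-elim (X≢Y refl)
  (col , col , X≢Y , _)     → ⊥-elim (X≢Y refl)
  (row , col , _   , pairs) → let s = RayImages.block-sends φ aut row col pairs in
    inj₁ (Product.map₂ proj₁ ∘ s , Product.map₂ proj₂ ∘ s) , Product.map₂ inj₁ ∘ s
  (col , row , _   , pairs) → let s = RayImages.block-sends φ aut col row pairs in
    inj₂ (Product.map₂ proj₁ ∘ s , Product.map₂ proj₂ ∘ s) , Product.map₂ inj₂ ∘ s
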